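{- Let $G$ and $H$ be finite simple graphs. If $G\in\mathfrak{F}$ and $H$ is a Roman graph, then $G\boxtimes H$ is a Roman graph.
   Context: $\gamma(X)$ denotes the domination number of a graph $X$ (minimum size of a set $D$ such that every vertex outside $D$ has a neighbor in $D$). A Roman dominating function on $X$ is a map $f:V(X)\to\{0,1,2\}$ such that every vertex $v$ with $f(v)=0$ has a neighbor $u$ with $f(u)=2$; $\gamma_R(X)$ is the minimum of $\sum_v f(v)$ over such $f$. A graph $X$ is Roman if $\gamma_R(X)=2\gamma(X)$. $\mathfrak{F}$ is the class of graphs $G$ having a dominating set $S=\{u_1,\dots,u_{\gamma(G)}\}$ of size $\gamma(G)$ with $N[u_i]\cap N[u_j]=\emptyset$ for all $i\ne j$, where $N[u]$ is the closed neighborhood of $u$. The strong product $G\boxtimes H$ has vertex set $V(G)\times V(H)$, with distinct $(g,h),(g',h')$ adjacent iff ($g=g'$ and $h\sim h'$) or ($g\sim g'$ and $h=h'$) or ($g\sim g'$ and $h\sim h'$). -}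

module Defs where

open import Data.Nat using (ℕ; zero; suc; _+_; _*_)
open import Data.Fin using (Fin; zero; suc; toℕ; remQuot)
open import Data.Fin.Subset using (Subset; _∈_; _∉_; ∣_∣)
open import Data.Product using (Σ; ∃; _×_; _,_; proj₁; proj₂)
open import Data.Sum using (_⊎_)
open import Relation.Binary.PropositionalEquality using (_≡_; _≢_)
open import Relation.Nullary using (¬_; Dec)
open import Level using (0ℓ)
open import Data.Fin.Properties using (_≟_)
open import Data.Sum using (inj₁; inj₂)
open import Relation.Nullary using (yes; no)
open import Relation.Nullary.Decidable using (_×-dec_; _⊎-dec_)
import Relation.Binary.PropositionalEquality as Eq

record Graph (n : ℕ) : Set₁ where
  field
    Adj    : Fin n → Fin n → Set
    adj?   : ∀ u v → Dec (Adj u v)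
    irrefl : ∀ u → ¬ Adj u u
    sym    : ∀ {u v} → Adj u v → Adj v u
open Graph public

InClosedNbhd : ∀ {n} → Graph n → Fin n → Fin n → Set
InClosedNbhd G u v = v ≡ u ⊎ Adj G u v

IsDominating : ∀ {n} → Graph n → Subset n → Set
IsDominating G D = ∀ v → v ∉ D → ∃ λ u → u ∈ D × Adj G v u

IsDomNumber : ∀ {n} → Graph n → ℕ → Set
IsDomNumber G k =
  (∃ λ D → IsDominating G D × ∣ D ∣ ≡ k) ×
  (∀ D → IsDominating G D → k Data.Nat.≤ ∣ D ∣)

sumFin : ∀ {n} → (Fin n → ℕ) → ℕ
sumFin {zero}  f = 0
sumFin {suc n} f = f zero + sumFin (λ i → f (suc i))

IsRDF : ∀ {n} → Graph n → (Fin n → Fin 3) → Set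
IsRDF G f = ∀ v → f v ≡ zero → ∃ λ u → Adj G v u × f u ≡ suc (suc zero)

weight : ∀ {n} → (Fin n → Fin 3) → ℕ
weight f = sumFin (λ v → toℕ (f v))

IsRomanDomNumber : ∀ {n} → Graph n → ℕ → Set
IsRomanDomNumber G r =
  (∃ λ f → IsRDF G f × weight f ≡ r) ×
  (∀ f → IsRDF G f → r Data.Nat.≤ weight f)

IsRoman : ∀ {n} → Graph n → Set
IsRoman G = ∀ k r → IsDomNumber G k → IsRomanDomNumber G r → r ≡ 2 * k

InClassF : ∀ {n} → Graph n → Set
InClassF G = ∃ λ S → IsDominating G S × IsDomNumber G ∣ S ∣ ×
  (∀ u v → u ∈ S → v ∈ S → u ≢ v → ∀ w → ¬ (InClosedNbhd G u w × InClosedNbhd G v w))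

-- Strong product on Fin (n * m), vertices decoded as pairs via remQuot (a bijection)
StrongAdjPair : ∀ {n m} → Graph n → Graph m → (Fin n × Fin m) → (Fin n × Fin m) → Set
StrongAdjPair G H (g , h) (g' , h') =
  (g ≡ g' × Adj H h h') ⊎ ((Adj G g g' × h ≡ h') ⊎ (Adj G g g' × Adj H h h'))

strong-adj? : ∀ {n m} (G : Graph n) (H : Graph m) p q → Dec (StrongAdjPair G H p q)
strong-adj? G H (g , h) (g' , h') =
  ((g ≟ g') ×-dec adj? H h h') ⊎-dec
  ((adj? G g g' ×-dec (h ≟ h')) ⊎-dec (adj? G g g' ×-dec adj? H h h'))

strong-irrefl : ∀ {n m} (G : Graph n) (H : Graph m) p → ¬ StrongAdjPair G H p p
strong-irrefl G H (g , h) (inj₁ (_ , a)) = irrefl H h a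
strong-irrefl G H (g , h) (inj₂ (inj₁ (a , _))) = irrefl G g a
strong-irrefl G H (g , h) (inj₂ (inj₂ (a , _))) = irrefl G g a

strong-sym : ∀ {n m} (G : Graph n) (H : Graph m) {p q} →
  StrongAdjPair G H p q → StrongAdjPair G H q p
strong-sym G H (inj₁ (e , a)) = inj₁ (Eq.sym e , sym H a)
strong-sym G H (inj₂ (inj₁ (a , e))) = inj₂ (inj₁ (sym G a , Eq.sym e))
strong-sym G H (inj₂ (inj₂ (a , b))) = inj₂ (inj₂ (sym G a , sym H b))

_⊠_ : ∀ {n m} → Graph n → Graph m → Graph (n * m)
_⊠_ {n} {m} G H = record
  { Adj    = λ i j → StrongAdjPair G H (remQuot m i) (remQuot m j)
  ; adj?   = λ i j → strong-adj? G H (remQuot m i) (remQuot m j)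
  ; irrefl = λ i → strong-irrefl G H (remQuot m i)
  ; sym    = strong-sym G H
  }

-- Let S witness G ∈ 𝔉 and let T be a minimum dominating set of H. Closed neighbourhoods in
-- G ⊠ H are products of closed neighbourhoods, so S × T dominates G ⊠ H and
-- γ(G ⊠ H) ≤ |S| γ(H). Conversely, given a Roman dominating function f of G ⊠ H and u ∈ S,
-- the map h ↦ min(2, Σ_{w ∈ N[u]} f(w, h)) is a Roman dominating function of H, so its weight,
-- at most the weight of f on N[u] × V(H), is at least γ_R(H). The sets N[u] × V(H), u ∈ S,
-- are disjoint, hence γ_R(G ⊠ H) ≥ |S| γ_R(H) = 2 |S| γ(H) ≥ 2 γ(G ⊠ H). The reverse
-- inequality γ_R ≤ 2γ holds in every graph.
module Submission where

open import Defs hiding (sym)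
open import Data.Nat.Base using (ℕ; zero; suc; _+_; _*_; _≤_; _<_; z≤n; s≤s)
open import Data.Nat.Properties as ℕ
  using ( ≤-refl; ≤-trans; ≤-antisym; ≤-reflexive; ≮⇒≥; +-mono-≤; +-assoc; +-identityʳ
        ; *-comm; *-monoʳ-≤; m≤m+n; m≤n+m; n≤0⇒n≡0; anyUpTo?; module ≤-Reasoning )
open import Data.Nat.Induction using (<-rec)
open import Algebra.Properties.Semiring.Sum ℕ.+-*-semiring
  using (sum; sum-syntax; sum-cong-≗; sum-replicate-zero; ∑-comm)
open import Algebra.Properties.CommutativeSemigroup ℕ.*-commutativeSemigroup using (x∙yz≈y∙xz)
open import Data.Bool.Base using (true; false; if_then_else_)
open import Data.Fin.Base
  using (Fin; zero; suc; toℕ; combine; remQuot; _↑ˡ_; _↑ʳ_; finToFun; funToFin)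
open import Data.Fin.Patterns using (0F; 1F; 2F)
open import Data.Fin.Properties
  using ( _≟_; any?; all?; 0≢1+n; suc-injective; toℕ-injective
        ; combine-remQuot; remQuot-combine; finToFun-funToFin )
open import Data.Fin.Subset using (Subset; _∈_; _∉_; ∣_∣; ⊤) renaming (⊥ to ∅)
open import Data.Fin.Subset.Properties using (_∈?_; anySubset?; ∈⊤; ∣⊥∣≡0)
open import Data.Vec.Base using ([]; _∷_; _++_; here; there)
open import Data.Product.Base using (∃; ∃₂; _×_; _,_; uncurry)
open import Data.Sum.Base using (inj₁; inj₂)
open import Function.Base using (_∘_; const)
open import Level using (Level)
open import Relation.Nullary using (¬_; Dec; yes; no; does; contradiction)
open import Relation.Nullary.Decidable
  using (map′; decidable-stable; _×-dec_; _⊎-dec_; _→-dec_; ¬?)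
open import Relation.Unary using (Pred; Decidable)
open import Relation.Binary.PropositionalEquality
  using (_≡_; _≢_; _≗_; refl; sym; trans; cong; cong₂; subst; subst₂; module ≡-Reasoning)

private
  variable
    p q : Level
    k n m N : ℕ

sumFin≡sum : (f : Fin n → ℕ) → sumFin f ≡ sum f
sumFin≡sum {zero}  f = refl
sumFin≡sum {suc n} f = cong (f zero +_) (sumFin≡sum (f ∘ suc))

sum-mono-≤ : {f g : Fin n → ℕ} → (∀ i → f i ≤ g i) → sum f ≤ sum g
sum-mono-≤ {zero}  f≤g = z≤n
sum-mono-≤ {suc n} f≤g = +-mono-≤ (f≤g zero) (sum-mono-≤ (f≤g ∘ suc))

term≤sum : (f : Fin n → ℕ) (i : Fin n) → f i ≤ sum f
term≤sum f zero    = m≤m+n (f zero) _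
term≤sum f (suc i) = ≤-trans (term≤sum (f ∘ suc) i) (m≤n+m _ (f zero))

sum-↑ : ∀ k (f : Fin (k + n) → ℕ) → sum f ≡ sum (f ∘ (_↑ˡ n)) + sum (f ∘ (k ↑ʳ_))
sum-↑ zero    f = refl
sum-↑ (suc k) f = trans (cong (f zero +_) (sum-↑ k (f ∘ suc))) (sym (+-assoc (f zero) _ _))

sum-combine : ∀ n (f : Fin (n * m) → ℕ) → sum f ≡ ∑[ g < n ] ∑[ h < m ] f (combine g h)
sum-combine zero          f = refl
sum-combine {m} (suc n) f =
  trans (sum-↑ m f) (cong (sum (f ∘ (_↑ˡ n * m)) +_) (sum-combine n (f ∘ (m ↑ʳ_))))

when : {P : Set p} → Dec P → ℕ → ℕ
when d x = if does d then x else 0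

module _ {P : Set p} where

  when-holds : ∀ {x} → P → (d : Dec P) → when d x ≡ x
  when-holds _ (yes _) = refl
  when-holds p (no ¬p) = contradiction p ¬p

  when-fails : ∀ {x} → ¬ P → (d : Dec P) → when d x ≡ 0
  when-fails ¬p (yes p) = contradiction p ¬p
  when-fails _  (no _)  = refl

  when-mono : ∀ {x y} (d : Dec P) → x ≤ y → when d x ≤ when d y
  when-mono (yes _) x≤y = x≤y
  when-mono (no _)  _   = z≤n

  when-sum : (d : Dec P) (f : Fin n → ℕ) → when d (sum f) ≡ ∑[ i < n ] when d (f i)
  when-sum (yes _) f = refl
  when-sum {n} (no _) f = sym (sum-replicate-zero n)

  when-×-dec : ∀ {Q : Set q} {x} (d : Dec P) (e : Dec Q) →
               when d (when e x) ≡ when (d ×-dec e) x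
  when-×-dec (yes _) (yes _) = refl
  when-×-dec (yes _) (no _)  = refl
  when-×-dec (no _)  _       = refl

sum-when≤ : {P : Pred (Fin n) p} (P? : Decidable P) → (∀ {i j} → P i → P j → i ≡ j) →
            ∀ x → ∑[ i < n ] when (P? i) x ≤ x
sum-when≤ {zero}  P? unique x = z≤n
sum-when≤ {suc n} P? unique x with P? zero
... | yes P0 = ≤-reflexive (trans (cong (x +_) rest≡0) (+-identityʳ x))
  where
  rest≡0 : ∑[ i < n ] when (P? (suc i)) x ≡ 0
  rest≡0 = trans (sum-cong-≗ (λ i → when-fails (0≢1+n ∘ unique P0) (P? (suc i))))
                 (sum-replicate-zero n)
... | no _ = sum-when≤ (P? ∘ suc) (λ Pi Pj → suc-injective (unique Pi Pj)) x

sum-when-disjoint≤ : {P : Pred (Fin k) p} {Q : Fin k → Pred (Fin n) q}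
  (P? : Decidable P) (Q? : ∀ u → Decidable (Q u)) →
  (∀ {u v w} → P u → P v → Q u w → Q v w → u ≡ v) → (a : Fin n → ℕ) →
  ∑[ u < k ] when (P? u) (∑[ w < n ] when (Q? u w) (a w)) ≤ ∑[ w < n ] a w
sum-when-disjoint≤ {k} {n = n} P? Q? unique a = begin
  ∑[ u < k ] when (P? u) (∑[ w < n ] when (Q? u w) (a w))
    ≡⟨ sum-cong-≗ (λ u → when-sum (P? u) (λ w → when (Q? u w) (a w))) ⟩
  ∑[ u < k ] ∑[ w < n ] when (P? u) (when (Q? u w) (a w))
    ≡⟨ ∑-comm (λ u w → when (P? u) (when (Q? u w) (a w))) ⟩
  ∑[ w < n ] ∑[ u < k ] when (P? u) (when (Q? u w) (a w))
    ≡⟨ sum-cong-≗ (λ w → sum-cong-≗ (λ u → when-×-dec (P? u) (Q? u w))) ⟩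
  ∑[ w < n ] ∑[ u < k ] when (P? u ×-dec Q? u w) (a w)
    ≤⟨ sum-mono-≤ (λ w → sum-when≤ (λ u → P? u ×-dec Q? u w)
                                   (λ (Pu , Qu) (Pv , Qv) → unique Pu Pv Qu Qv) (a w)) ⟩
  ∑[ w < n ] a w ∎
  where open ≤-Reasoning

∣p∣*x≡sum-when : (s : Subset n) (x : ℕ) → ∣ s ∣ * x ≡ ∑[ i < n ] when (i ∈? s) x
∣p∣*x≡sum-when []          x = refl
∣p∣*x≡sum-when (true ∷ s)  x = cong (x +_) (∣p∣*x≡sum-when s x)
∣p∣*x≡sum-when (false ∷ s) x = ∣p∣*x≡sum-when s x

∣p++q∣ : (s : Subset n) {t : Subset m} → ∣ s ++ t ∣ ≡ ∣ s ∣ + ∣ t ∣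
∣p++q∣ []          = refl
∣p++q∣ (true ∷ s)  = cong suc (∣p++q∣ s)
∣p++q∣ (false ∷ s) = ∣p++q∣ s

∈-++⁺ˡ : ∀ {i : Fin n} {s : Subset n} {t : Subset m} → i ∈ s → i ↑ˡ m ∈ s ++ t
∈-++⁺ˡ here         = here
∈-++⁺ˡ (there i∈s) = there (∈-++⁺ˡ i∈s)

∈-++⁺ʳ : ∀ {i : Fin m} (s : Subset n) {t : Subset m} → i ∈ t → n ↑ʳ i ∈ s ++ t
∈-++⁺ʳ []      i∈t = i∈t
∈-++⁺ʳ (_ ∷ s) i∈t = there (∈-++⁺ʳ s i∈t)

-- S × T, with (g , h) stored at index combine g h.
infixr 7 _⊗_
_⊗_ : Subset n → Subset m → Subset (n * m)
[]          ⊗ t = []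
(true ∷ s)  ⊗ t = t ++ s ⊗ t
(false ∷ s) ⊗ t = ∅ ++ s ⊗ t

∣⊗∣ : (s : Subset n) (t : Subset m) → ∣ s ⊗ t ∣ ≡ ∣ s ∣ * ∣ t ∣
∣⊗∣ []          t = refl
∣⊗∣ (true ∷ s)  t = trans (∣p++q∣ t) (cong (∣ t ∣ +_) (∣⊗∣ s t))
∣⊗∣ {m = m} (false ∷ s) t =
  trans (∣p++q∣ (∅ {m})) (cong₂ _+_ (∣⊥∣≡0 m) (∣⊗∣ s t))

combine-∈-⊗ : ∀ {g : Fin n} {h : Fin m} {s t} → g ∈ s → h ∈ t → combine g h ∈ s ⊗ t
combine-∈-⊗ here h∈t = ∈-++⁺ˡ h∈t
combine-∈-⊗ {s = true ∷ _}  {t} (there g∈s) h∈t = ∈-++⁺ʳ t (combine-∈-⊗ g∈s h∈t)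
combine-∈-⊗ {s = false ∷ _}     (there g∈s) h∈t = ∈-++⁺ʳ ∅ (combine-∈-⊗ g∈s h∈t)

combine-elim : (P : Pred (Fin (n * m)) p) → (∀ g h → P (combine g h)) → ∀ i → P i
combine-elim {n} {m} P P-combine i =
  subst P (combine-remQuot {n} m i) (uncurry P-combine (remQuot {n} m i))

-- Maps are enumerated through Fin (k ^ n), which recovers them only up to ≗.
any→? : {P : Pred (Fin n → Fin k) p} → (∀ {f g} → f ≗ g → P f → P g) → Decidable P →
        Dec (∃ P)
any→? resp P? = map′ (λ (c , Pc) → finToFun c , Pc)
                     (λ (f , Pf) → funToFin f , resp (sym ∘ finToFun-funToFin f) Pf)
                     (any? (P? ∘ finToFun))

Least : Pred ℕ p → Set p
Least P = ∃ λ k → P k × (∀ i → P i → k ≤ i)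

least-witness : {P : Pred ℕ p} → Decidable P → ∀ w → P w → Least P
least-witness {P = P} P? = <-rec (λ w → P w → Least P) search
  where
  search : ∀ w → (∀ {v} → v < w → P v → Least P) → P w → Least P
  search w below Pw with anyUpTo? P? w
  ... | yes (v , v<w , Pv) = below v<w Pv
  ... | no ∄ = w , Pw , λ i Pi → ≮⇒≥ (λ i<w → ∄ (i , i<w , Pi))

closedNbhd? : (X : Graph N) → ∀ u v → Dec (InClosedNbhd X u v)
closedNbhd? X u v = (v ≟ u) ⊎-dec adj? X u v

MeetsClosedNbhds : Graph N → Subset N → Set
MeetsClosedNbhds X D = ∀ v → ∃ λ u → u ∈ D × InClosedNbhd X v u

dominating⇒meetsClosedNbhds : (X : Graph N) {D : Subset N} →
                              IsDominating X D → MeetsClosedNbhds X D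
dominating⇒meetsClosedNbhds X {D} dom v with v ∈? D
... | yes v∈D = v , v∈D , inj₁ refl
... | no  v∉D = let (u , u∈D , adj) = dom v v∉D in u , u∈D , inj₂ adj

meetsClosedNbhds⇒dominating : (X : Graph N) {D : Subset N} →
                              MeetsClosedNbhds X D → IsDominating X D
meetsClosedNbhds⇒dominating X meets v v∉D with meets v
... | u , u∈D , inj₁ refl = contradiction u∈D v∉D
... | u , u∈D , inj₂ adj  = u , u∈D , adj

isDominating? : (X : Graph N) → Decidable (IsDominating X)
isDominating? X D = all? (λ v → ¬? (v ∈? D) →-dec any? (λ u → (u ∈? D) ×-dec adj? X v u))

γ-exists : (X : Graph N) → ∃ (IsDomNumber X)
γ-exists X
  with least-witness (λ j → anySubset? (λ D → isDominating? X D ×-dec (∣ D ∣ ℕ.≟ j)))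
                     _ (⊤ , (λ v v∉⊤ → contradiction ∈⊤ v∉⊤) , refl)
... | γ , minimum , least = γ , minimum , λ D dom → least _ (D , dom , refl)

isRDF? : (X : Graph N) → Decidable (IsRDF X)
isRDF? X f = all? (λ v → (f v ≟ 0F) →-dec any? (λ u → adj? X v u ×-dec (f u ≟ 2F)))

isRDF-resp-≗ : (X : Graph N) {f g : Fin N → Fin 3} → f ≗ g → IsRDF X f → IsRDF X g
isRDF-resp-≗ X f≗g rdf v gv≡0 =
  let (u , adj , fu≡2) = rdf v (trans (f≗g v) gv≡0) in u , adj , trans (sym (f≗g u)) fu≡2

weight-resp-≗ : {f g : Fin N → Fin 3} → f ≗ g → weight f ≡ weight g
weight-resp-≗ {f = f} {g} f≗g = begin
  weight f        ≡⟨ sumFin≡sum (toℕ ∘ f) ⟩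
  sum (toℕ ∘ f)   ≡⟨ sum-cong-≗ (cong toℕ ∘ f≗g) ⟩
  sum (toℕ ∘ g)   ≡⟨ sumFin≡sum (toℕ ∘ g) ⟨
  weight g        ∎
  where open ≡-Reasoning

γR-exists : (X : Graph N) → ∃ (IsRomanDomNumber X)
γR-exists {N} X
  with least-witness (λ j → any→? (resp j) (λ f → isRDF? X f ×-dec (weight f ℕ.≟ j)))
                     _ (const 1F , (λ _ ()) , refl)
  where
  resp : ∀ j {f g : Fin N → Fin 3} → f ≗ g →
         IsRDF X f × weight f ≡ j → IsRDF X g × weight g ≡ j
  resp j f≗g (rdf , weight≡j) =
    isRDF-resp-≗ X f≗g rdf , trans (sym (weight-resp-≗ f≗g)) weight≡j
... | γR , minimum , least = γR , minimum , λ f rdf → least _ (f , rdf , refl)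

twoIf : {P : Set p} → Dec P → Fin 3
twoIf d = if does d then 2F else 0F

twoIf-holds : {P : Set p} → P → (d : Dec P) → twoIf d ≡ 2F
twoIf-holds _ (yes _) = refl
twoIf-holds p (no ¬p) = contradiction p ¬p

toℕ-twoIf : {P : Set p} (d : Dec P) → toℕ (twoIf d) ≡ when d 2
toℕ-twoIf (yes _) = refl
toℕ-twoIf (no _)  = refl

γR≤2*∣D∣ : (X : Graph N) {D : Subset N} {γR : ℕ} →
           IsDominating X D → IsRomanDomNumber X γR → γR ≤ 2 * ∣ D ∣
γR≤2*∣D∣ {N} X {D} dom (_ , least) = subst (_ ≤_) weight≡2∣D∣ (least f rdf)
  where
  f : Fin N → Fin 3
  f v = twoIf (v ∈? D)
  rdf : IsRDF X f
  rdf v fv≡0 = let (u , u∈D , adj) = dom v v∉D in u , adj , twoIf-holds u∈D (u ∈? D)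
    where
    v∉D : v ∉ D
    v∉D v∈D = contradiction (trans (sym (twoIf-holds v∈D (v ∈? D))) fv≡0) λ ()
  weight≡2∣D∣ : weight f ≡ 2 * ∣ D ∣
  weight≡2∣D∣ = begin
    weight f                        ≡⟨ sumFin≡sum (toℕ ∘ f) ⟩
    ∑[ v < N ] toℕ (twoIf (v ∈? D)) ≡⟨ sum-cong-≗ (λ v → toℕ-twoIf (v ∈? D)) ⟩
    ∑[ v < N ] when (v ∈? D) 2      ≡⟨ sym (∣p∣*x≡sum-when D 2) ⟩
    ∣ D ∣ * 2                       ≡⟨ *-comm ∣ D ∣ 2 ⟩
    2 * ∣ D ∣                       ∎
    where open ≡-Reasoning

module _ {n m} (G : Graph n) (H : Graph m) where

  ⊠-adj : ∀ {g g' h h'} → StrongAdjPair G H (g , h) (g' , h') →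
          Adj (G ⊠ H) (combine g h) (combine g' h')
  ⊠-adj {g} {g'} {h} {h'} =
    subst₂ (StrongAdjPair G H) (sym (remQuot-combine g h)) (sym (remQuot-combine g' h'))

  ⊠-adj⁻ : ∀ {g g' h h'} → Adj (G ⊠ H) (combine g h) (combine g' h') →
           StrongAdjPair G H (g , h) (g' , h')
  ⊠-adj⁻ {g} {g'} {h} {h'} =
    subst₂ (StrongAdjPair G H) (remQuot-combine g h) (remQuot-combine g' h')

  ⊠-closedNbhd : ∀ {g g' h h'} → InClosedNbhd G g g' → InClosedNbhd H h h' →
                 InClosedNbhd (G ⊠ H) (combine g h) (combine g' h')
  ⊠-closedNbhd (inj₁ refl) (inj₁ refl) = inj₁ refl
  ⊠-closedNbhd (inj₁ refl) (inj₂ b)    = inj₂ (⊠-adj (inj₁ (refl , b)))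
  ⊠-closedNbhd (inj₂ a)    (inj₁ refl) = inj₂ (⊠-adj (inj₂ (inj₁ (a , refl))))
  ⊠-closedNbhd (inj₂ a)    (inj₂ b)    = inj₂ (⊠-adj (inj₂ (inj₂ (a , b))))

  strongAdj⇒closedNbhds : ∀ {g g' h h'} → StrongAdjPair G H (g , h) (g' , h') →
                          InClosedNbhd G g g' × InClosedNbhd H h h'
  strongAdj⇒closedNbhds (inj₁ (refl , b))        = inj₁ refl , inj₂ b
  strongAdj⇒closedNbhds (inj₂ (inj₁ (a , refl))) = inj₂ a , inj₁ refl
  strongAdj⇒closedNbhds (inj₂ (inj₂ (a , b)))    = inj₂ a , inj₂ b

  ⊗-dominating : ∀ {S T} → IsDominating G S → IsDominating H T →
                 IsDominating (G ⊠ H) (S ⊗ T)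
  ⊗-dominating {S} {T} domS domT =
    meetsClosedNbhds⇒dominating (G ⊠ H) (combine-elim {n} {m} _ meets)
    where
    meets : ∀ g h → ∃ λ u → u ∈ S ⊗ T × InClosedNbhd (G ⊠ H) (combine g h) u
    meets g h =
      let (g' , g'∈S , gg') = dominating⇒meetsClosedNbhds G domS g
          (h' , h'∈T , hh') = dominating⇒meetsClosedNbhds H domT h
      in combine g' h' , combine-∈-⊗ g'∈S h'∈T , ⊠-closedNbhd gg' hh'

  rdf-neighbour : ∀ {f} → IsRDF (G ⊠ H) f → ∀ {g h} → f (combine g h) ≡ 0F →
                  ∃₂ λ g' h' → StrongAdjPair G H (g , h) (g' , h') × f (combine g' h') ≡ 2F
  rdf-neighbour {f} rdf {g} {h} fgh≡0 =
    let (j , adj , fj≡2) = rdf _ fgh≡0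
    in combine-elim {n} {m} (λ j → Adj (G ⊠ H) (combine g h) j → f j ≡ 2F → _)
                    (λ g' h' adj fj≡2 → g' , h' , ⊠-adj⁻ adj , fj≡2) j adj fj≡2

cap : ℕ → Fin 3
cap 0             = 0F
cap 1             = 1F
cap (suc (suc _)) = 2F

toℕ-cap≤ : ∀ x → toℕ (cap x) ≤ x
toℕ-cap≤ 0             = z≤n
toℕ-cap≤ 1             = ≤-refl
toℕ-cap≤ (suc (suc x)) = s≤s (s≤s z≤n)

cap≡0⇒≡0 : ∀ x → cap x ≡ 0F → x ≡ 0
cap≡0⇒≡0 0             _  = refl
cap≡0⇒≡0 1             ()
cap≡0⇒≡0 (suc (suc _)) ()

2≤x⇒cap≡2 : ∀ x → 2 ≤ x → cap x ≡ 2F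
2≤x⇒cap≡2 1             (s≤s ())
2≤x⇒cap≡2 (suc (suc x)) _ = refl

module Projection {n m} (G : Graph n) (H : Graph m) (f : Fin (n * m) → Fin 3) where

  value : Fin n → Fin m → ℕ
  value g h = toℕ (f (combine g h))

  row : Fin n → ℕ
  row g = ∑[ h < m ] value g h

  mass : Fin n → Fin m → ℕ
  mass u h = ∑[ w < n ] when (closedNbhd? G u w) (value w h)

  project : Fin n → Fin m → Fin 3
  project u h = cap (mass u h)

  value≤mass : ∀ {u w} h → InClosedNbhd G u w → value w h ≤ mass u h
  value≤mass {u} {w} h w∈N[u] = begin
    value w h
      ≡⟨ when-holds w∈N[u] (closedNbhd? G u w) ⟨
    when (closedNbhd? G u w) (value w h)
      ≤⟨ term≤sum (λ w → when (closedNbhd? G u w) (value w h)) w ⟩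
    mass u h
      ∎
    where open ≤-Reasoning

  project-isRDF : IsRDF (G ⊠ H) f → ∀ u → IsRDF H (project u)
  project-isRDF rdf u h project≡0 = neighbourInH (rdf-neighbour G H rdf fuh≡0)
    where
    mass≡0 : mass u h ≡ 0
    mass≡0 = cap≡0⇒≡0 _ project≡0
    fuh≡0 : f (combine u h) ≡ 0F
    fuh≡0 =
      toℕ-injective (n≤0⇒n≡0 (subst (value u h ≤_) mass≡0 (value≤mass h (inj₁ refl))))
    2≤mass : ∀ {g' h'} → InClosedNbhd G u g' → f (combine g' h') ≡ 2F → 2 ≤ mass u h'
    2≤mass {h' = h'} g'∈N[u] fg'h'≡2 =
      subst (_≤ mass u h') (cong toℕ fg'h'≡2) (value≤mass h' g'∈N[u])
    neighbourInH : (∃₂ λ g' h' → StrongAdjPair G H (u , h) (g' , h') ×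
                                 f (combine g' h') ≡ 2F) →
                   ∃ λ h' → Adj H h h' × project u h' ≡ 2F
    neighbourInH (g' , h' , adj , fg'h'≡2) with strongAdj⇒closedNbhds G H adj
    ... | g'∈N[u] , inj₁ refl =
      contradiction (subst (2 ≤_) mass≡0 (2≤mass g'∈N[u] fg'h'≡2)) λ ()
    ... | g'∈N[u] , inj₂ hh'  = h' , hh' , 2≤x⇒cap≡2 _ (2≤mass g'∈N[u] fg'h'≡2)

  weight-project≤ : ∀ u → weight (project u) ≤ ∑[ w < n ] when (closedNbhd? G u w) (row w)
  weight-project≤ u = begin
    weight (project u)
      ≡⟨ sumFin≡sum (toℕ ∘ project u) ⟩
    ∑[ h < m ] toℕ (cap (mass u h))
      ≤⟨ sum-mono-≤ (λ h → toℕ-cap≤ (mass u h)) ⟩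
    ∑[ h < m ] ∑[ w < n ] when (closedNbhd? G u w) (value w h)
      ≡⟨ ∑-comm (λ h w → when (closedNbhd? G u w) (value w h)) ⟩
    ∑[ w < n ] ∑[ h < m ] when (closedNbhd? G u w) (value w h)
      ≡⟨ sum-cong-≗ (λ w → when-sum (closedNbhd? G u w) (value w)) ⟨
    ∑[ w < n ] when (closedNbhd? G u w) (row w)
      ∎
    where open ≤-Reasoning

  weight≡sum-row : weight f ≡ ∑[ w < n ] row w
  weight≡sum-row = trans (sumFin≡sum (toℕ ∘ f)) (sum-combine n (toℕ ∘ f))

∣S∣*γR≤weight : ∀ {n m} (G : Graph n) (H : Graph m) {S : Subset n} {γR : ℕ} →
  (∀ u v → u ∈ S → v ∈ S → u ≢ v →
     ∀ w → ¬ (InClosedNbhd G u w × InClosedNbhd G v w)) →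
  IsRomanDomNumber H γR → ∀ {f} → IsRDF (G ⊠ H) f → ∣ S ∣ * γR ≤ weight f
∣S∣*γR≤weight {n} G H {S} {γR} disjoint (_ , least) {f} rdf = begin
  ∣ S ∣ * γR
    ≡⟨ ∣p∣*x≡sum-when S γR ⟩
  ∑[ u < n ] when (u ∈? S) γR
    ≤⟨ sum-mono-≤ (λ u → when-mono (u ∈? S) (γR≤N[u]-weight u)) ⟩
  ∑[ u < n ] when (u ∈? S) (∑[ w < n ] when (closedNbhd? G u w) (row w))
    ≤⟨ sum-when-disjoint≤ (_∈? S) (closedNbhd? G) unique row ⟩
  ∑[ w < n ] row w
    ≡⟨ weight≡sum-row ⟨
  weight f
    ∎
  where
  open Projection G H f
  open ≤-Reasoning
  γR≤N[u]-weight : ∀ u → γR ≤ ∑[ w < n ] when (closedNbhd? G u w) (row w)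
  γR≤N[u]-weight u = ≤-trans (least _ (project-isRDF rdf u)) (weight-project≤ u)
  unique : ∀ {u v w} → u ∈ S → v ∈ S → InClosedNbhd G u w → InClosedNbhd G v w → u ≡ v
  unique {u} {v} {w} u∈S v∈S w∈N[u] w∈N[v] =
    decidable-stable (u ≟ v) (λ u≢v → disjoint u v u∈S v∈S u≢v w (w∈N[u] , w∈N[v]))

theorem27 : ∀ {n m} (G : Graph n) (H : Graph m) →
    InClassF G → IsRoman H → IsRoman (G ⊠ H)
theorem27 G H (S , S-dom , _ , S-disjoint) H-roman γ γR
          ((D , D-dom , ∣D∣≡γ) , γ-least) γR-number@((f , f-rdf , weight≡γR) , _)
  with γ-exists H | γR-exists H
... | γH , H-γ@((T , T-dom , ∣T∣≡γH) , _) | γRH , H-γR = ≤-antisym γR≤2γ 2γ≤γR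
  where
  open ≤-Reasoning
  γR≤2γ : γR ≤ 2 * γ
  γR≤2γ = subst (λ d → γR ≤ 2 * d) ∣D∣≡γ (γR≤2*∣D∣ (G ⊠ H) D-dom γR-number)
  γ≤∣S∣γH : γ ≤ ∣ S ∣ * γH
  γ≤∣S∣γH = subst (γ ≤_) (trans (∣⊗∣ S T) (cong (∣ S ∣ *_) ∣T∣≡γH))
                         (γ-least (S ⊗ T) (⊗-dominating G H S-dom T-dom))
  2γ≤γR : 2 * γ ≤ γR
  2γ≤γR = begin
    2 * γ             ≤⟨ *-monoʳ-≤ 2 γ≤∣S∣γH ⟩
    2 * (∣ S ∣ * γH)  ≡⟨ x∙yz≈y∙xz 2 ∣ S ∣ γH ⟩
    ∣ S ∣ * (2 * γH)  ≡⟨ cong (∣ S ∣ *_) (sym (H-roman γH γRH H-γ H-γR)) ⟩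
    ∣ S ∣ * γRH       ≤⟨ ∣S∣*γR≤weight G H S-disjoint H-γR f-rdf ⟩
    weight f          ≡⟨ weight≡γR ⟩
    γR                ∎
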